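{- For all integers $p\ge0$, $\zeta\in\{0,1\}$, $n\ge0$ and $0\le k\le n$, \[E_{n,k}(-1,2;\,2-\zeta+2p,\,\zeta-2p)=n!\binom{n+1}{2k+2p+1-\zeta}-(-1)^{k+p}\sum_{\ell=0}^{p-1}(-1)^\ell(2-\zeta+2\ell)^{\overline n}\binom{n+1}{k+p-\ell}.\]
   Context: For complex parameters $(\alpha,\beta,\gamma;\alpha',\beta',\gamma')$, the GKP triangle is the unique array $T_{n,k}$, $0\le k\le n$ ($T_{n,k}=0$ if $k<0$ or $k>n$), with $T_{0,0}=1$ and $T_{n+1,k+1}=[\alpha n+\beta(k+1)+\gamma]T_{n,k+1}+[\alpha' n+\beta' k+\gamma']T_{n,k}$ for $n\ge0$, $k\ge-1$. The generalized Eulerian numbers $E_{n,k}(a,b;c_0,c_\infty)$ form the GKP triangle with parameters $(-a,b,c_0;\,a+b,-b,c_\infty)$. $x^{\overline m}=x(x+1)\cdots(x+m-1)$; binomial coefficients $\binom{m}{j}$ with $j<0$ or $j>m$ are $0$. -}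

module Defs where

open import Data.Nat as ℕ using (ℕ; zero; suc)
import Data.Integer
open import Data.Integer using (ℤ; +_; -[1+_]; _+_; _*_; -_; _-_)
open import Data.Nat.Combinatorics using (_C_)

-- T n k for k : ℕ; T n k = 0 for k > n holds automatically since T 0 (suc k) = 0
-- and the recurrence preserves it; T n (-1) = 0 is built in at k = 0.
GKP : (α β γ α' β' γ' : ℤ) → ℕ → ℕ → ℤ
GKP α β γ α' β' γ' zero zero = + 1
GKP α β γ α' β' γ' zero (suc k) = + 0
GKP α β γ α' β' γ' (suc n) zero =
  (α * + n + β * + 0 + γ) * GKP α β γ α' β' γ' n zero
GKP α β γ α' β' γ' (suc n) (suc k) =
  (α * + n + β * + (suc k) + γ) * GKP α β γ α' β' γ' n (suc k)
  + (α' * + n + β' * + k + γ') * GKP α β γ α' β' γ' n k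

E : (a b c₀ c∞ : ℤ) → ℕ → ℕ → ℤ
E a b c₀ c∞ = GKP (- a) b c₀ (a + b) (- b) c∞

rising : ℤ → ℕ → ℤ
rising x zero = + 1
rising x (suc m) = rising x m * (x + + m)

-- binomial coefficient with integer lower index (0 outside [0,m])
binomℤ : ℕ → ℤ → ℤ
binomℤ m (+ j) = + (m C j)
binomℤ m -[1+ _ ] = + 0

sgnℕ : ℕ → ℤ
sgnℕ zero = + 1
sgnℕ (suc zero) = - + 1
sgnℕ (suc (suc j)) = sgnℕ j

sgn : ℤ → ℤ
sgn (+ j) = sgnℕ j
sgn -[1+ j ] = sgnℕ (suc j)

Σ< : ℕ → (ℕ → ℤ) → ℤ
Σ< zero f = + 0
Σ< (suc p) f = Σ< p f + f p

{-# OPTIONS --safe #-}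
-- Both sides satisfy the GKP recurrence of E(-1,2;c₀,2-c₀), extended to all integer columns
-- k: n! C(n+1, 2k+c₀-1) does by Pascal's rule and absorption, and so does every
-- (-1)^(k+s) (c₀-2s)^(n) C(n+1, k+s).  A solution vanishing in column -1 whose row 0 is the
-- unit row is the triangle.  The right-hand side for p+1 is the one for p moved one column
-- left, plus (-1)^k c₀^(n) C(n+1, k+1); hence row 0 reduces to p = 0 (where ζ ∈ {0,1} makes it
-- the unit row), and column -1 for p+1 is column 0 for p, i.e. c₀^(n), minus c₀^(n).
module Submission where

open import Defs
open import Data.Nat using (ℕ; zero; suc; _≤_; _!)
import Data.Nat as ℕ
import Data.Nat.Properties as ℕₚ
open import Data.Nat.Combinatorics using (_C_; nC1≡n; nCk+nC[k+1]≡[n+1]C[k+1])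
import Data.Nat.Tactic.RingSolver as ℕ-Solver
open import Data.Fin using (Fin; toℕ)
import Data.Fin as Fin
open import Data.Integer using (ℤ; +_; -[1+_]; _+_; _*_; -_; _-_)
import Data.Integer.Properties as ℤₚ
open import Data.Integer.Tactic.RingSolver using (solve-∀)
open import Data.List using (_∷_; [])
open import Relation.Binary.PropositionalEquality
  using (_≡_; refl; sym; trans; cong; cong₂; subst; module ≡-Reasoning)
open ≡-Reasoning

C-absorb : ∀ m j → suc j ℕ.* (m C suc j) ℕ.+ j ℕ.* (m C j) ≡ m ℕ.* (m C j)
C-absorb zero    zero    = refl
C-absorb zero    (suc j) = cong₂ ℕ._+_ (ℕₚ.*-zeroʳ (suc (suc j))) (ℕₚ.*-zeroʳ (suc j))
C-absorb (suc m) zero    = begin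
  1 ℕ.* (suc m C 1) ℕ.+ 0  ≡⟨ cong (λ c → 1 ℕ.* c ℕ.+ 0) (nC1≡n (suc m)) ⟩
  1 ℕ.* suc m ℕ.+ 0        ≡⟨ ℕ-Solver.solve (m ∷ []) ⟩
  suc m ℕ.* 1              ∎
C-absorb (suc m) (suc j) = begin
    suc (suc j) ℕ.* (suc m C suc (suc j)) ℕ.+ suc j ℕ.* (suc m C suc j)
  ≡⟨ cong₂ (λ x y → suc (suc j) ℕ.* x ℕ.+ suc j ℕ.* y)
       (sym (nCk+nC[k+1]≡[n+1]C[k+1] m (suc j))) (sym (nCk+nC[k+1]≡[n+1]C[k+1] m j)) ⟩
    suc (suc j) ℕ.* (b ℕ.+ c) ℕ.+ suc j ℕ.* (a ℕ.+ b)
  ≡⟨ regroup j a b c ⟩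
    (suc (suc j) ℕ.* c ℕ.+ suc j ℕ.* b) ℕ.+ (suc j ℕ.* b ℕ.+ j ℕ.* a) ℕ.+ b ℕ.+ a
  ≡⟨ cong₂ (λ x y → x ℕ.+ y ℕ.+ b ℕ.+ a) (C-absorb m (suc j)) (C-absorb m j) ⟩
    m ℕ.* b ℕ.+ m ℕ.* a ℕ.+ b ℕ.+ a
  ≡⟨ collect m a b ⟩
    suc m ℕ.* (a ℕ.+ b)
  ≡⟨ cong (suc m ℕ.*_) (nCk+nC[k+1]≡[n+1]C[k+1] m j) ⟩
    suc m ℕ.* (suc m C suc j)
  ∎
  where
  a = m C j
  b = m C suc j
  c = m C suc (suc j)
  regroup : ∀ j a b c → suc (suc j) ℕ.* (b ℕ.+ c) ℕ.+ suc j ℕ.* (a ℕ.+ b)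
    ≡ (suc (suc j) ℕ.* c ℕ.+ suc j ℕ.* b) ℕ.+ (suc j ℕ.* b ℕ.+ j ℕ.* a) ℕ.+ b ℕ.+ a
  regroup = ℕ-Solver.solve-∀
  collect : ∀ m a b → m ℕ.* b ℕ.+ m ℕ.* a ℕ.+ b ℕ.+ a ≡ suc m ℕ.* (a ℕ.+ b)
  collect = ℕ-Solver.solve-∀

binomℤ-pascal : ∀ m j → binomℤ (suc m) (+ 1 + j) ≡ binomℤ m j + binomℤ m (+ 1 + j)
binomℤ-pascal m (+ j)        = cong +_ (sym (nCk+nC[k+1]≡[n+1]C[k+1] m j))
binomℤ-pascal m -[1+ zero ]  = refl
binomℤ-pascal m -[1+ suc j ] = refl

binomℤ-absorb : ∀ m j → (+ 1 + j) * binomℤ m (+ 1 + j) ≡ (+ m - j) * binomℤ m j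
binomℤ-absorb m (+ j) = begin
    + suc j * b₁
  ≡⟨ add-and-subtract (+ suc j * b₁) (+ j) b₀ ⟩
    (+ suc j * b₁ + + j * b₀) - + j * b₀
  ≡⟨ cong (_- + j * b₀) lifted ⟩
    + m * b₀ - + j * b₀
  ≡⟨ factor (+ m) (+ j) b₀ ⟩
    (+ m - + j) * b₀
  ∎
  where
  b₀ = + (m C j)
  b₁ = + (m C suc j)
  lifted : + suc j * b₁ + + j * b₀ ≡ + m * b₀
  lifted = begin
    + suc j * b₁ + + j * b₀              ≡⟨ sym (cong₂ _+_ (ℤₚ.pos-* (suc j) _) (ℤₚ.pos-* j _)) ⟩
    + (suc j ℕ.* (m C suc j) ℕ.+ j ℕ.* (m C j)) ≡⟨ cong +_ (C-absorb m j) ⟩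
    + (m ℕ.* (m C j))                    ≡⟨ ℤₚ.pos-* m _ ⟩
    + m * b₀                             ∎
  add-and-subtract : ∀ x y b → x ≡ (x + y * b) - y * b
  add-and-subtract = solve-∀
  factor : ∀ x y b → x * b - y * b ≡ (x - y) * b
  factor = solve-∀
binomℤ-absorb m -[1+ zero ]  = sym (ℤₚ.*-zeroʳ (+ m - -[1+ zero ]))
binomℤ-absorb m -[1+ suc j ] =
  trans (ℤₚ.*-zeroʳ -[1+ j ]) (sym (ℤₚ.*-zeroʳ (+ m - -[1+ suc j ])))

sgnℕ-suc : ∀ j → sgnℕ (suc j) ≡ - sgnℕ j
sgnℕ-suc zero          = refl
sgnℕ-suc (suc zero)    = refl
sgnℕ-suc (suc (suc j)) = sgnℕ-suc j

sgnℕ-square : ∀ j → sgnℕ j * sgnℕ j ≡ + 1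
sgnℕ-square zero          = refl
sgnℕ-square (suc zero)    = refl
sgnℕ-square (suc (suc j)) = sgnℕ-square j

sgn-suc : ∀ k → sgn (+ 1 + k) ≡ - sgn k
sgn-suc (+ j)          = sgnℕ-suc j
sgn-suc -[1+ zero ]    = refl
sgn-suc -[1+ suc j ]   = sgnℕ-suc j

sgn-pred : ∀ k → sgn (k - + 1) ≡ - sgn k
sgn-pred k = begin
  sgn (k - + 1)               ≡⟨ sym (ℤₚ.neg-involutive _) ⟩
  - - sgn (k - + 1)           ≡⟨ cong -_ (sym (sgn-suc (k - + 1))) ⟩
  - sgn (+ 1 + (k - + 1))     ≡⟨ cong (λ i → - sgn i) (cancel k) ⟩
  - sgn k                     ∎
  where
  cancel : ∀ k → + 1 + (k - + 1) ≡ k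
  cancel = solve-∀

sgn-+-pos : ∀ a j → sgn (a + + j) ≡ sgn a * sgnℕ j
sgn-+-pos a zero    = trans (cong sgn (ℤₚ.+-identityʳ a)) (sym (ℤₚ.*-identityʳ (sgn a)))
sgn-+-pos a (suc j) = begin
  sgn (a + + suc j)        ≡⟨ cong sgn (shift a (+ j)) ⟩
  sgn (+ 1 + (a + + j))    ≡⟨ sgn-suc (a + + j) ⟩
  - sgn (a + + j)          ≡⟨ cong -_ (sgn-+-pos a j) ⟩
  - (sgn a * sgnℕ j)       ≡⟨ ℤₚ.neg-distribʳ-* (sgn a) (sgnℕ j) ⟩
  sgn a * - sgnℕ j         ≡⟨ cong (sgn a *_) (sym (sgnℕ-suc j)) ⟩
  sgn a * sgnℕ (suc j)     ∎
  where
  shift : ∀ a b → a + (+ 1 + b) ≡ + 1 + (a + b)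
  shift = solve-∀

sgn-+-neg : ∀ a j → sgn (a - + j) ≡ sgn a * sgnℕ j
sgn-+-neg a zero    = trans (cong sgn (ℤₚ.+-identityʳ a)) (sym (ℤₚ.*-identityʳ (sgn a)))
sgn-+-neg a (suc j) = begin
  sgn (a - + suc j)        ≡⟨ cong sgn (shift a (+ j)) ⟩
  sgn ((a - + j) - + 1)    ≡⟨ sgn-pred (a - + j) ⟩
  - sgn (a - + j)          ≡⟨ cong -_ (sgn-+-neg a j) ⟩
  - (sgn a * sgnℕ j)       ≡⟨ ℤₚ.neg-distribʳ-* (sgn a) (sgnℕ j) ⟩
  sgn a * - sgnℕ j         ≡⟨ cong (sgn a *_) (sym (sgnℕ-suc j)) ⟩
  sgn a * sgnℕ (suc j)     ∎
  where
  shift : ∀ a b → a - (+ 1 + b) ≡ (a - b) - + 1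
  shift = solve-∀

sgn-+ : ∀ a b → sgn (a + b) ≡ sgn a * sgn b
sgn-+ a (+ j)    = sgn-+-pos a j
sgn-+ a -[1+ j ] = sgn-+-neg a (suc j)

sgn-neg : ∀ j → sgn (- + j) ≡ sgnℕ j
sgn-neg zero    = refl
sgn-neg (suc j) = refl

Σ<-cong : ∀ p {f g : ℕ → ℤ} → (∀ ℓ → f ℓ ≡ g ℓ) → Σ< p f ≡ Σ< p g
Σ<-cong zero    f≗g = refl
Σ<-cong (suc p) f≗g = cong₂ _+_ (Σ<-cong p f≗g) (f≗g p)

*-distribˡ-Σ< : ∀ c p (f : ℕ → ℤ) → c * Σ< p f ≡ Σ< p (λ ℓ → c * f ℓ)
*-distribˡ-Σ< c zero    f = ℤₚ.*-zeroʳ c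
*-distribˡ-Σ< c (suc p) f =
  trans (ℤₚ.*-distribˡ-+ c (Σ< p f) (f p)) (cong (_+ c * f p) (*-distribˡ-Σ< c p f))

-- On all integer columns; the column is written + 1 + k so that it reduces to + suc k on ℕ.
record GKPRecurrence (α β γ α' β' γ' : ℤ) (f : ℕ → ℤ → ℤ) : Set where
  field
    step : ∀ n k →
      f (suc n) (+ 1 + k) ≡ (α * + n + β * (+ 1 + k) + γ) * f n (+ 1 + k) + (α' * + n + β' * k + γ') * f n k

open GKPRecurrence

module _ {α β γ α' β' γ' : ℤ} where

  GKPRecurrence-cong : ∀ {f g} → (∀ n k → f n k ≡ g n k) →
    GKPRecurrence α β γ α' β' γ' f → GKPRecurrence α β γ α' β' γ' g
  GKPRecurrence-cong {f} {g} f≗g rec .step n k = begin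
    g (suc n) (+ 1 + k)                  ≡⟨ sym (f≗g (suc n) (+ 1 + k)) ⟩
    f (suc n) (+ 1 + k)                  ≡⟨ rec .step n k ⟩
    A * f n (+ 1 + k) + B * f n k        ≡⟨ cong₂ (λ x y → A * x + B * y) (f≗g n (+ 1 + k)) (f≗g n k) ⟩
    A * g n (+ 1 + k) + B * g n k        ∎
    where
    A = α * + n + β * (+ 1 + k) + γ
    B = α' * + n + β' * k + γ'

  GKPRecurrence-+ : ∀ {f g} → GKPRecurrence α β γ α' β' γ' f → GKPRecurrence α β γ α' β' γ' g →
    GKPRecurrence α β γ α' β' γ' (λ n k → f n k + g n k)
  GKPRecurrence-+ {f} {g} recf recg .step n k =
    trans (cong₂ _+_ (recf .step n k) (recg .step n k)) (distrib A B (f n (+ 1 + k)) (f n k) (g n (+ 1 + k)) (g n k))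
    where
    A = α * + n + β * (+ 1 + k) + γ
    B = α' * + n + β' * k + γ'
    distrib : ∀ a b x y u v → (a * x + b * y) + (a * u + b * v) ≡ a * (x + u) + b * (y + v)
    distrib = solve-∀

  GKPRecurrence-− : ∀ {f g} → GKPRecurrence α β γ α' β' γ' f → GKPRecurrence α β γ α' β' γ' g →
    GKPRecurrence α β γ α' β' γ' (λ n k → f n k - g n k)
  GKPRecurrence-− {f} {g} recf recg .step n k =
    trans (cong₂ _-_ (recf .step n k) (recg .step n k)) (distrib A B (f n (+ 1 + k)) (f n k) (g n (+ 1 + k)) (g n k))
    where
    A = α * + n + β * (+ 1 + k) + γ
    B = α' * + n + β' * k + γ'
    distrib : ∀ a b x y u v → (a * x + b * y) - (a * u + b * v) ≡ a * (x - u) + b * (y - v)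
    distrib = solve-∀

  GKPRecurrence-Σ< : ∀ p {f : ℕ → ℕ → ℤ → ℤ} → (∀ ℓ → GKPRecurrence α β γ α' β' γ' (f ℓ)) →
    GKPRecurrence α β γ α' β' γ' (λ n k → Σ< p (λ ℓ → f ℓ n k))
  GKPRecurrence-Σ< zero    recf .step n k =
    zero-combination (α * + n + β * (+ 1 + k) + γ) (α' * + n + β' * k + γ')
    where
    zero-combination : ∀ a b → + 0 ≡ a * + 0 + b * + 0
    zero-combination = solve-∀
  GKPRecurrence-Σ< (suc p) recf = GKPRecurrence-+ (GKPRecurrence-Σ< p recf) (recf p)

  GKP-unique : ∀ {f} → GKPRecurrence α β γ α' β' γ' f → (∀ n → f n -[1+ 0 ] ≡ + 0) →
    f 0 (+ 0) ≡ + 1 → (∀ k → f 0 (+ suc k) ≡ + 0) →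
    ∀ n k → GKP α β γ α' β' γ' n k ≡ f n (+ k)
  GKP-unique rec vanish row₀ row₀-suc zero    zero    = sym row₀
  GKP-unique rec vanish row₀ row₀-suc zero    (suc k) = sym (row₀-suc k)
  GKP-unique {f} rec vanish row₀ row₀-suc (suc n) zero = begin
      A * GKP α β γ α' β' γ' n 0
    ≡⟨ cong (A *_) (GKP-unique rec vanish row₀ row₀-suc n 0) ⟩
      A * f n (+ 0)
    ≡⟨ sym (ℤₚ.+-identityʳ _) ⟩
      A * f n (+ 0) + + 0
    ≡⟨ cong (λ t → A * f n (+ 0) + t) (sym (trans (cong (B *_) (vanish n)) (ℤₚ.*-zeroʳ B))) ⟩
      A * f n (+ 0) + B * f n -[1+ 0 ]
    ≡⟨ sym (rec .step n -[1+ 0 ]) ⟩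
      f (suc n) (+ 0)
    ∎
    where
    A = α * + n + β * + 0 + γ
    B = α' * + n + β' * -[1+ 0 ] + γ'
  GKP-unique rec vanish row₀ row₀-suc (suc n) (suc k) =
    trans (cong₂ (λ x y → (α * + n + β * + suc k + γ) * x + (α' * + n + β' * + k + γ') * y)
             (GKP-unique rec vanish row₀ row₀-suc n (suc k)) (GKP-unique rec vanish row₀ row₀-suc n k))
          (sym (rec .step n (+ k)))

GKP-column₀ : ∀ {β γ α' β' γ'} n → GKP (+ 1) β γ α' β' γ' n 0 ≡ rising γ n
GKP-column₀                   zero    = refl
GKP-column₀ {β} {γ} {α'} {β'} {γ'} (suc n) =
  trans (cong ((+ 1 * + n + β * + 0 + γ) *_) (GKP-column₀ {β} {γ} {α'} {β'} {γ'} n))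
        (reorder (+ n) β γ (rising γ n))
  where
  reorder : ∀ n b c r → (+ 1 * n + b * + 0 + c) * r ≡ r * (c + n)
  reorder = solve-∀

binomialSolution : ℤ → ℕ → ℤ → ℤ
binomialSolution c₀ n k = + (n !) * binomℤ (suc n) (+ 2 * k + c₀ - + 1)

binomialSolution-recurrence : ∀ c₀ →
  GKPRecurrence (+ 1) (+ 2) c₀ (+ 1) (- + 2) (+ 2 - c₀) (binomialSolution c₀)
binomialSolution-recurrence c₀ .step n k = begin
    + (suc n !) * binomℤ (suc (suc n)) (+ 2 * (+ 1 + k) + c₀ - + 1)
  ≡⟨ cong₂ (λ M i → M * binomℤ (suc (suc n)) i) (ℤₚ.pos-* (suc n) (n !)) (index-step k c₀) ⟩
    + suc n * N * binomℤ (suc (suc n)) (+ 1 + (+ 1 + j))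
  ≡⟨ cong (+ suc n * N *_) (binomℤ-pascal (suc n) (+ 1 + j)) ⟩
    + suc n * N * (u₁ + u₂)
  ≡⟨ rearrange (+ n) k c₀ N u₀ u₁ u₂ ⟩
    A * (N * u₂) + B * (N * u₀)
      - N * (((+ 1 + (+ 1 + j)) * u₂ - w₁) - ((+ 1 + j) * u₁ - w₀))
  ≡⟨ cong₂ (λ x y → A * (N * u₂) + B * (N * u₀) - N * ((x - w₁) - (y - w₀)))
       (binomℤ-absorb (suc n) (+ 1 + j)) (binomℤ-absorb (suc n) j) ⟩
    A * (N * u₂) + B * (N * u₀) - N * ((w₁ - w₁) - (w₀ - w₀))
  ≡⟨ drop-defects (A * (N * u₂) + B * (N * u₀)) N w₁ w₀ ⟩
    A * (N * u₂) + B * (N * u₀)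
  ≡⟨ cong (λ i → A * (N * binomℤ (suc n) i) + B * (N * u₀)) (sym (index-step k c₀)) ⟩
    A * binomialSolution c₀ n (+ 1 + k) + B * binomialSolution c₀ n k
  ∎
  where
  N  = + (n !)
  j  = + 2 * k + c₀ - + 1
  u₀ = binomℤ (suc n) j
  u₁ = binomℤ (suc n) (+ 1 + j)
  u₂ = binomℤ (suc n) (+ 1 + (+ 1 + j))
  w₀ = (+ suc n - j) * u₀
  w₁ = (+ suc n - (+ 1 + j)) * u₁
  A  = + 1 * + n + + 2 * (+ 1 + k) + c₀
  B  = + 1 * + n + - + 2 * k + (+ 2 - c₀)
  index-step : ∀ k c₀ → + 2 * (+ 1 + k) + c₀ - + 1 ≡ + 1 + (+ 1 + (+ 2 * k + c₀ - + 1))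
  index-step = solve-∀
  rearrange : ∀ n k c₀ N u₀ u₁ u₂ →
    (+ 1 + n) * N * (u₁ + u₂)
      ≡ (+ 1 * n + + 2 * (+ 1 + k) + c₀) * (N * u₂) + (+ 1 * n + - + 2 * k + (+ 2 - c₀)) * (N * u₀)
        - N * (((+ 1 + (+ 1 + (+ 2 * k + c₀ - + 1))) * u₂ - (+ 1 + n - (+ 1 + (+ 2 * k + c₀ - + 1))) * u₁)
               - ((+ 1 + (+ 2 * k + c₀ - + 1)) * u₁ - (+ 1 + n - (+ 2 * k + c₀ - + 1)) * u₀))
  rearrange = solve-∀
  drop-defects : ∀ x N a b → x - N * ((a - a) - (b - b)) ≡ x
  drop-defects = solve-∀

risingSolution : ℤ → ℤ → ℕ → ℤ → ℤ
risingSolution c₀ s n k = sgn (k + s) * rising (c₀ - + 2 * s) n * binomℤ (suc n) (k + s)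

risingSolution-recurrence : ∀ c₀ s →
  GKPRecurrence (+ 1) (+ 2) c₀ (+ 1) (- + 2) (+ 2 - c₀) (risingSolution c₀ s)
risingSolution-recurrence c₀ s .step n k = begin
    sgn ((+ 1 + k) + s) * (R * (x + + n)) * binomℤ (suc (suc n)) ((+ 1 + k) + s)
  ≡⟨ cong (λ i → sgn i * (R * (x + + n)) * binomℤ (suc (suc n)) i) (ℤₚ.+-assoc (+ 1) k s) ⟩
    sgn (+ 1 + j) * (R * (x + + n)) * binomℤ (suc (suc n)) (+ 1 + j)
  ≡⟨ cong₂ (λ σ' b → σ' * (R * (x + + n)) * b) (sgn-suc j) (binomℤ-pascal (suc n) j) ⟩
    - σ * (R * (x + + n)) * (u + v)
  ≡⟨ rearrange (+ n) k s c₀ σ R u v ⟩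
    A * (- σ * R * v) + B * (σ * R * u) + + 2 * σ * R * ((+ 1 + j) * v - w)
  ≡⟨ cong (λ t → A * (- σ * R * v) + B * (σ * R * u) + + 2 * σ * R * (t - w))
       (binomℤ-absorb (suc n) j) ⟩
    A * (- σ * R * v) + B * (σ * R * u) + + 2 * σ * R * (w - w)
  ≡⟨ drop-defect (A * (- σ * R * v) + B * (σ * R * u)) (+ 2 * σ * R) w ⟩
    A * (- σ * R * v) + B * (σ * R * u)
  ≡⟨ cong (λ t → A * t + B * (σ * R * u)) (sym next-column) ⟩
    A * risingSolution c₀ s n (+ 1 + k) + B * risingSolution c₀ s n k
  ∎
  where
  j = k + s
  x = c₀ - + 2 * s
  σ = sgn j
  R = rising x n
  u = binomℤ (suc n) j
  v = binomℤ (suc n) (+ 1 + j)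
  w = (+ suc n - j) * u
  A = + 1 * + n + + 2 * (+ 1 + k) + c₀
  B = + 1 * + n + - + 2 * k + (+ 2 - c₀)
  next-column : risingSolution c₀ s n (+ 1 + k) ≡ - σ * R * v
  next-column = begin
    sgn ((+ 1 + k) + s) * R * binomℤ (suc n) ((+ 1 + k) + s)
      ≡⟨ cong (λ i → sgn i * R * binomℤ (suc n) i) (ℤₚ.+-assoc (+ 1) k s) ⟩
    sgn (+ 1 + j) * R * v
      ≡⟨ cong (λ σ' → σ' * R * v) (sgn-suc j) ⟩
    - σ * R * v ∎
  rearrange : ∀ n k s c₀ σ R u v →
    - σ * (R * ((c₀ - + 2 * s) + n)) * (u + v)
      ≡ (+ 1 * n + + 2 * (+ 1 + k) + c₀) * (- σ * R * v) + (+ 1 * n + - + 2 * k + (+ 2 - c₀)) * (σ * R * u)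
        + + 2 * σ * R * ((+ 1 + (k + s)) * v - (+ 1 + n - (k + s)) * u)
  rearrange = solve-∀
  drop-defect : ∀ y c a → y + c * (a - a) ≡ y
  drop-defect = solve-∀

c₀ : ℕ → ℕ → ℤ
c₀ z p = + 2 - + z + + 2 * + p

c∞ : ℕ → ℕ → ℤ
c∞ z p = + z - + 2 * + p

closedForm : ℕ → ℕ → ℕ → ℤ → ℤ
closedForm z p n k = + (n !) * binomℤ (suc n) (+ 2 * k + + 2 * + p + + 1 - + z)
  - sgn (k + + p) * Σ< p (λ ℓ → sgn (+ ℓ) * rising (+ 2 - + z + + 2 * + ℓ) n * binomℤ (suc n) (k + + p - + ℓ))

closedForm-decomposition : ∀ z p n k → closedForm z p n k
  ≡ binomialSolution (c₀ z p) n k - Σ< p (λ ℓ → risingSolution (c₀ z p) (+ p - + ℓ) n k)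
closedForm-decomposition z p n k =
  cong₂ _-_ (cong (λ i → + (n !) * binomℤ (suc n) i) (index (+ z) (+ p) k))
            (trans (*-distribˡ-Σ< (sgn (k + + p)) p _) (Σ<-cong p summand))
  where
  index : ∀ z p k → + 2 * k + + 2 * p + + 1 - z ≡ + 2 * k + (+ 2 - z + + 2 * p) - + 1
  index = solve-∀
  summand : ∀ ℓ → sgn (k + + p) * (sgn (+ ℓ) * rising (+ 2 - + z + + 2 * + ℓ) n * binomℤ (suc n) (k + + p - + ℓ))
                ≡ risingSolution (c₀ z p) (+ p - + ℓ) n k
  summand ℓ = begin
      sgn (k + + p) * (sgn (+ ℓ) * r * b)
    ≡⟨ reassociate (sgn (k + + p)) (sgn (+ ℓ)) r b ⟩
      sgn (k + + p) * sgn (+ ℓ) * r * b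
    ≡⟨ cong (λ σ → σ * r * b) sign ⟩
      sgn (k + + p - + ℓ) * r * b
    ≡⟨ cong₂ (λ i y → sgn i * rising y n * binomℤ (suc n) i)
         (sym (shift k (+ p) (+ ℓ))) (sym (base (+ z) (+ p) (+ ℓ))) ⟩
      risingSolution (c₀ z p) (+ p - + ℓ) n k
    ∎
    where
    r = rising (+ 2 - + z + + 2 * + ℓ) n
    b = binomℤ (suc n) (k + + p - + ℓ)
    sign : sgn (k + + p) * sgn (+ ℓ) ≡ sgn (k + + p - + ℓ)
    sign = sym (trans (sgn-+ (k + + p) (- + ℓ)) (cong (sgn (k + + p) *_) (sgn-neg ℓ)))
    reassociate : ∀ a b c d → a * (b * c * d) ≡ a * b * c * d
    reassociate = solve-∀
    shift : ∀ k p ℓ → k + (p - ℓ) ≡ k + p - ℓ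
    shift = solve-∀
    base : ∀ z p ℓ → (+ 2 - z + + 2 * p) - + 2 * (p - ℓ) ≡ + 2 - z + + 2 * ℓ
    base = solve-∀

closedForm-recurrence : ∀ z p →
  GKPRecurrence (+ 1) (+ 2) (c₀ z p) (+ 1) (- + 2) (c∞ z p) (closedForm z p)
closedForm-recurrence z p =
  subst (λ γ' → GKPRecurrence (+ 1) (+ 2) (c₀ z p) (+ 1) (- + 2) γ' (closedForm z p))
        (complement (+ z) (+ p))
        (GKPRecurrence-cong (λ n k → sym (closedForm-decomposition z p n k))
          (GKPRecurrence-− (binomialSolution-recurrence (c₀ z p))
                           (GKPRecurrence-Σ< p (λ ℓ → risingSolution-recurrence (c₀ z p) (+ p - + ℓ)))))
  where
  complement : ∀ z p → + 2 - (+ 2 - z + + 2 * p) ≡ z - + 2 * p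
  complement = solve-∀

closedForm-shift : ∀ z p n k →
  closedForm z (suc p) n k ≡ closedForm z p n (+ 1 + k) + sgn k * rising (c₀ z p) n * binomℤ (suc n) (+ 1 + k)
closedForm-shift z p n k = begin
    closedForm z (suc p) n k
  ≡⟨ cong₂ (λ i t → N * binomℤ (suc n) i - t) (index (+ z) (+ p) k)
       (cong₂ _*_ (cong sgn (sign-index k (+ p)))
         (cong₂ _+_ (Σ<-cong p (λ ℓ → cong (term ℓ) (summand-index k (+ p) (+ ℓ))))
                    (cong (term p) (last-index k (+ p))))) ⟩
    N * b' - S * (Σ' + sgnℕ p * r * b)
  ≡⟨ split-last (N * b') S Σ' (sgnℕ p) r b ⟩
    (N * b' - S * Σ') - S * sgnℕ p * r * b
  ≡⟨ cong (λ t → (N * b' - S * Σ') - t * r * b) sign-cancels ⟩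
    (N * b' - S * Σ') - - sgn k * r * b
  ≡⟨ double-negation (N * b' - S * Σ') (sgn k) r b ⟩
    closedForm z p n (+ 1 + k) + sgn k * r * b
  ∎
  where
  N  = + (n !)
  r  = rising (c₀ z p) n
  b  = binomℤ (suc n) (+ 1 + k)
  b' = binomℤ (suc n) (+ 2 * (+ 1 + k) + + 2 * + p + + 1 - + z)
  S  = sgn ((+ 1 + k) + + p)
  term : ℕ → ℤ → ℤ
  term ℓ i = sgn (+ ℓ) * rising (+ 2 - + z + + 2 * + ℓ) n * binomℤ (suc n) i
  Σ' = Σ< p (λ ℓ → term ℓ ((+ 1 + k) + + p - + ℓ))
  sign-cancels : S * sgnℕ p ≡ - sgn k
  sign-cancels = begin
    S * sgnℕ p                         ≡⟨ cong (_* sgnℕ p) (sgn-+ (+ 1 + k) (+ p)) ⟩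
    sgn (+ 1 + k) * sgnℕ p * sgnℕ p    ≡⟨ cong (λ σ → σ * sgnℕ p * sgnℕ p) (sgn-suc k) ⟩
    - sgn k * sgnℕ p * sgnℕ p          ≡⟨ ℤₚ.*-assoc (- sgn k) (sgnℕ p) (sgnℕ p) ⟩
    - sgn k * (sgnℕ p * sgnℕ p)        ≡⟨ cong (- sgn k *_) (sgnℕ-square p) ⟩
    - sgn k * + 1                      ≡⟨ ℤₚ.*-identityʳ (- sgn k) ⟩
    - sgn k                            ∎
  index : ∀ z p k → + 2 * k + + 2 * (+ 1 + p) + + 1 - z ≡ + 2 * (+ 1 + k) + + 2 * p + + 1 - z
  index = solve-∀
  sign-index : ∀ k p → k + (+ 1 + p) ≡ (+ 1 + k) + p
  sign-index = solve-∀
  summand-index : ∀ k p ℓ → k + (+ 1 + p) - ℓ ≡ (+ 1 + k) + p - ℓ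
  summand-index = solve-∀
  last-index : ∀ k p → k + (+ 1 + p) - p ≡ + 1 + k
  last-index = solve-∀
  split-last : ∀ x s y t r b → x - s * (y + t * r * b) ≡ (x - s * y) - s * t * r * b
  split-last = solve-∀
  double-negation : ∀ y s r b → y - - s * r * b ≡ y + s * r * b
  double-negation = solve-∀

binomℤ-1-beyond : ∀ {i} j → i ≡ + 2 + + j → binomℤ 1 i ≡ + 0
binomℤ-1-beyond j refl = refl

closedForm-row₀-suc : ∀ (ζ : Fin 2) p k → closedForm (toℕ ζ) p 0 (+ suc k) ≡ + 0
closedForm-row₀-suc ζ zero k = begin
    + 1 * binomℤ 1 (+ 2 * + suc k + + 2 * + 0 + + 1 - + toℕ ζ) - sgn (+ suc k + + 0) * + 0
  ≡⟨ cong (λ c → + 1 * c - sgn (+ suc k + + 0) * + 0) (index-beyond ζ) ⟩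
    + 1 * + 0 - sgn (+ suc k + + 0) * + 0
  ≡⟨ zero-row (sgn (+ suc k + + 0)) ⟩
    + 0
  ∎
  where
  index-beyond : ∀ (ζ : Fin 2) → binomℤ 1 (+ 2 * + suc k + + 2 * + 0 + + 1 - + toℕ ζ) ≡ + 0
  index-beyond Fin.zero =
    binomℤ-1-beyond (1 ℕ.+ 2 ℕ.* k) (trans (index₀ (+ k)) (cong (λ t → + 2 + (+ 1 + t)) (sym (ℤₚ.pos-* 2 k))))
    where
    index₀ : ∀ k → + 2 * (+ 1 + k) + + 2 * + 0 + + 1 - + 0 ≡ + 2 + (+ 1 + + 2 * k)
    index₀ = solve-∀
  index-beyond (Fin.suc Fin.zero) =
    binomℤ-1-beyond (2 ℕ.* k) (trans (index₁ (+ k)) (cong (λ t → + 2 + t) (sym (ℤₚ.pos-* 2 k))))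
    where
    index₁ : ∀ k → + 2 * (+ 1 + k) + + 2 * + 0 + + 1 - + 1 ≡ + 2 + + 2 * k
    index₁ = solve-∀
  zero-row : ∀ s → + 1 * + 0 - s * + 0 ≡ + 0
  zero-row = solve-∀
closedForm-row₀-suc ζ (suc p) k = begin
    closedForm (toℕ ζ) (suc p) 0 (+ suc k)
  ≡⟨ closedForm-shift (toℕ ζ) p 0 (+ suc k) ⟩
    closedForm (toℕ ζ) p 0 (+ suc (suc k)) + sgn (+ suc k) * + 1 * + 0
  ≡⟨ cong (λ t → t + sgn (+ suc k) * + 1 * + 0) (closedForm-row₀-suc ζ p (suc k)) ⟩
    + 0 + sgn (+ suc k) * + 1 * + 0
  ≡⟨ zero-sum (sgn (+ suc k)) ⟩
    + 0
  ∎
  where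
  zero-sum : ∀ s → + 0 + s * + 1 * + 0 ≡ + 0
  zero-sum = solve-∀

closedForm-row₀ : ∀ (ζ : Fin 2) p → closedForm (toℕ ζ) p 0 (+ 0) ≡ + 1
closedForm-row₀ Fin.zero           zero    = refl
closedForm-row₀ (Fin.suc Fin.zero) zero    = refl
closedForm-row₀ ζ                  (suc p) =
  trans (closedForm-shift (toℕ ζ) p 0 (+ 0))
        (cong (λ t → t + sgn (+ 0) * + 1 * + 1) (closedForm-row₀-suc ζ p 0))

closedForm₀-column₋₁ : ∀ z n → closedForm z 0 n -[1+ 0 ] ≡ + 0
closedForm₀-column₋₁ z n =
  trans (cong (λ c → + (n !) * c - sgn (-[1+ 0 ] + + 0) * + 0) (negative-index z))
        (no-terms (+ (n !)) (sgn (-[1+ 0 ] + + 0)))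
  where
  negative-index : ∀ z → binomℤ (suc n) (+ 2 * -[1+ 0 ] + + 2 * + 0 + + 1 - + z) ≡ + 0
  negative-index zero    = refl
  negative-index (suc z) = refl
  no-terms : ∀ N s → N * + 0 - s * + 0 ≡ + 0
  no-terms = solve-∀

mutual
  E≡closedForm : ∀ (ζ : Fin 2) p n k →
    E (- + 1) (+ 2) (c₀ (toℕ ζ) p) (c∞ (toℕ ζ) p) n k ≡ closedForm (toℕ ζ) p n (+ k)
  E≡closedForm ζ p = GKP-unique (closedForm-recurrence (toℕ ζ) p)
    (closedForm-column₋₁ ζ p) (closedForm-row₀ ζ p) (closedForm-row₀-suc ζ p)

  closedForm-column₋₁ : ∀ (ζ : Fin 2) p n → closedForm (toℕ ζ) p n -[1+ 0 ] ≡ + 0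
  closedForm-column₋₁ ζ zero    n = closedForm₀-column₋₁ (toℕ ζ) n
  closedForm-column₋₁ ζ (suc p) n = begin
      closedForm z (suc p) n -[1+ 0 ]
    ≡⟨ closedForm-shift z p n -[1+ 0 ] ⟩
      closedForm z p n (+ 0) + - + 1 * r * + 1
    ≡⟨ cong (λ t → t + - + 1 * r * + 1) (sym (E≡closedForm ζ p n 0)) ⟩
      E (- + 1) (+ 2) (c₀ z p) (c∞ z p) n 0 + - + 1 * r * + 1
    ≡⟨ cong (λ t → t + - + 1 * r * + 1) (GKP-column₀ n) ⟩
      r + - + 1 * r * + 1
    ≡⟨ cancel r ⟩
      + 0
    ∎
    where
    z = toℕ ζ
    r = rising (c₀ z p) n
    cancel : ∀ r → r + - + 1 * r * + 1 ≡ + 0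
    cancel = solve-∀

-- The identity holds in every column k; both sides vanish for k > n.
theorem4p18 : (p : ℕ) (ζ : Fin 2) (n k : ℕ) → k ≤ n →
    E (- + 1) (+ 2) (+ 2 - + toℕ ζ + + 2 * + p) (+ toℕ ζ - + 2 * + p) n k
      ≡ + (n !) * binomℤ (suc n) (+ 2 * + k + + 2 * + p + + 1 - + toℕ ζ)
        - sgn (+ k + + p) * Σ< p (λ ℓ → sgn (+ ℓ) * rising (+ 2 - + toℕ ζ + + 2 * + ℓ) n * binomℤ (suc n) (+ k + + p - + ℓ))
theorem4p18 p ζ n k _ = E≡closedForm ζ p n k
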